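{- Let $\mathcal D=(\mathcal P,\mathcal B)$ be a $G$-locally transitive design with parameters $(v,b,r,k,\lambda)$. If the point stabilizer $G_\alpha$ is $2$-homogeneous on $\mathcal D(\alpha)$, then $\mathcal D$ is either symmetric, or quasi-symmetric with intersection numbers $0$ and $c$, where $c=\frac{(k-1)(\lambda-1)}{r-1}+1$ is an integer.
   Context: A design $\mathcal D=(\mathcal P,\mathcal B)$: $\mathcal P$ a finite set of $v$ points, $\mathcal B$ a set of $b$ blocks, each a $k$-subset of $\mathcal P$ with $k<v$, any two distinct points in exactly $\lambda>0$ common blocks, each point in $r$ blocks; designs are simple and non-trivial ($\mathcal B$ not the set of all $k$-subsets). $\mathcal D$ is symmetric if $v=b$, and quasi-symmetric with intersection numbers $\ell_1,\ell_2$ if any two distinct blocks meet in exactly $\ell_1$ or $\ell_2$ points. $\mathcal D(\alpha)$ is the set of blocks containing the point $\alpha$, $\mathcal D(\beta)=\beta$ for a block $\beta$. For $G\leqslant \mathrm{Aut}(\mathcal D)$, $\mathcal D$ is $G$-locally transitive if $G_\gamma$ is transitive on $\mathcal D(\gamma)$ for every $\gamma\in\mathcal P\cup\mathcal B$. -}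

module Defs where

open import Data.Nat using (ℕ; zero; suc; _<_; _∸_; _*_)
open import Data.Bool using (Bool; _∧_)
open import Data.Fin using (Fin)
open import Data.Fin.Subset using (Subset; _∈_; _∩_; ∣_∣)
open import Data.Fin.Permutation using (Permutation′; _⟨$⟩ʳ_; _⟨$⟩ˡ_; id; flip; _∘ₚ_)
open import Data.Vec using (lookup; tabulate)
open import Data.Product using (Σ; _×_; ∃; _,_)
open import Data.Sum using (_⊎_)
open import Relation.Binary.PropositionalEquality using (_≡_; _≢_)

Blocks : ℕ → ℕ → Set
Blocks v b = Fin b → Subset v

blocksThrough : ∀ {v b} → Blocks v b → Fin v → Subset b
blocksThrough B x = tabulate (λ j → lookup (B j) x)

blocksThrough₂ : ∀ {v b} → Blocks v b → Fin v → Fin v → Subset b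
blocksThrough₂ B x y = tabulate (λ j → lookup (B j) x ∧ lookup (B j) y)

record IsDesign (v b r k lam : ℕ) (B : Blocks v b) : Set where
  field
    simple      : ∀ i j → B i ≡ B j → i ≡ j
    blockSize   : ∀ j → ∣ B j ∣ ≡ k
    k<v         : k < v
    lam>0        : 0 < lam
    balanced    : ∀ x y → x ≢ y → ∣ blocksThrough₂ B x y ∣ ≡ lam
    replication : ∀ x → ∣ blocksThrough B x ∣ ≡ r
    nontrivial  : Σ (Subset v) (λ S → ∣ S ∣ ≡ k × (∀ j → B j ≢ S))

image : ∀ {v} → Permutation′ v → Subset v → Subset v
image g S = tabulate (λ y → lookup S (g ⟨$⟩ˡ y))

record IsAutGroup {v b} (B : Blocks v b) (G : Permutation′ v → Set) : Set where
  field
    id∈    : G id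
    ∘∈     : ∀ g h → G g → G h → G (g ∘ₚ h)
    inv∈   : ∀ g → G g → G (flip g)
    isAut  : ∀ g → G g → ∀ j → ∃ (λ j′ → image g (B j) ≡ B j′)

record LocallyTransitive {v b} (B : Blocks v b) (G : Permutation′ v → Set) : Set where
  field
    pointLocal : ∀ (α : Fin v) (j j′ : Fin b) → α ∈ B j → α ∈ B j′ →
                 ∃ (λ g → G g × (g ⟨$⟩ʳ α ≡ α) × (image g (B j) ≡ B j′))
    blockLocal : ∀ (j : Fin b) (x y : Fin v) → x ∈ B j → y ∈ B j →
                 ∃ (λ g → G g × (image g (B j) ≡ B j) × (g ⟨$⟩ʳ x ≡ y))

TwoHomogeneousAt : ∀ {v b} → Blocks v b → (Permutation′ v → Set) → Fin v → Set
TwoHomogeneousAt {v} {b} B G α =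
  ∀ (j₁ j₂ j₃ j₄ : Fin b) → j₁ ≢ j₂ → j₃ ≢ j₄ →
  α ∈ B j₁ → α ∈ B j₂ → α ∈ B j₃ → α ∈ B j₄ →
  ∃ (λ g → G g × (g ⟨$⟩ʳ α ≡ α) ×
     ((image g (B j₁) ≡ B j₃ × image g (B j₂) ≡ B j₄) ⊎
      (image g (B j₁) ≡ B j₄ × image g (B j₂) ≡ B j₃)))

QuasiSymmetric : ∀ {v b} → Blocks v b → ℕ → ℕ → Set
QuasiSymmetric {v} {b} B ℓ₁ ℓ₂ =
  ∀ (i j : Fin b) → i ≢ j → (∣ B i ∩ B j ∣ ≡ ℓ₁) ⊎ (∣ B i ∩ B j ∣ ≡ ℓ₂)

{-# OPTIONS --safe #-}
-- Two-homogeneity of G_α makes all pairs of distinct blocks through α meet in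
-- the same number c_α of points. Fixing a block B₀ ∋ α and counting the pairs
-- (x, B) with x ∈ B₀ ∩ B and α ∈ B ≠ B₀ in two ways gives
-- (r − 1) c_α = (r − 1) + (k − 1)(λ − 1), so c_α does not depend on α, and two
-- distinct blocks meet in either 0 or c = (k − 1)(λ − 1)/(r − 1) + 1 points.
-- When r ≤ 1 there is nothing to count: distinct blocks are disjoint.
module Submission where

open import Defs
open import Data.Nat using (ℕ; zero; suc; _+_; _*_; _∸_; _≤_; _<_; z≤n; s≤s; _≤?_; >-nonZero)
open import Data.Nat.Properties
open import Data.Bool using (Bool; true; false; _∧_)
open import Data.Fin using (Fin; zero; suc; punchIn; fromℕ<)
open import Data.Fin.Properties as Fin using (punchInᵢ≢i)
open import Data.Fin.Subset using (Subset; inside; outside; _∈_; _∩_; ∣_∣; Nonempty; Empty)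
open import Data.Fin.Subset.Properties
  using (nonempty?; Empty-unique; ∣⊥∣≡0; x∈p⇒∣p-x∣<∣p∣; x∈p∧x≢y⇒x∈p-y; x∈p∩q⁻; ∩-comm; ∣p∩q∣≤∣p∣)
open import Data.Fin.Permutation using (Permutation′; _⟨$⟩ˡ_; flip)
open import Data.Vec using ([]; _∷_; lookup; here; there)
open import Data.Vec.Properties
  using (lookup∘tabulate; lookup-zipWith; tabulate∘lookup; tabulate-cong; []=⇒lookup; lookup⇒[]=)
open import Data.Vec.Functional using (removeAt)
open import Data.Product using (Σ; ∃; ∃₂; _×_; _,_)
open import Data.Sum using (_⊎_; inj₁; inj₂)
open import Data.Empty using (⊥-elim)
open import Function using (_∘_)
open import Relation.Nullary using (¬_; yes; no; contradiction)
open import Relation.Binary.PropositionalEquality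
  using (_≡_; _≢_; refl; sym; trans; cong; cong₂; subst; module ≡-Reasoning)
open import Algebra.Properties.CommutativeSemigroup *-commutativeSemigroup using (x∙yz≈y∙xz)
open import Algebra.Properties.Semiring.Sum +-*-semiring
  using (sum; sum-cong-≗; sum-remove; ∑-comm; sum-permute; *-distribˡ-sum; *-distribʳ-sum)

indicator : Bool → ℕ
indicator true  = 1
indicator false = 0

𝟙 : ∀ {n} → Subset n → Fin n → ℕ
𝟙 p x = indicator (lookup p x)

indicator-∧ : ∀ a c → indicator (a ∧ c) ≡ indicator a * indicator c
indicator-∧ true  true  = refl
indicator-∧ true  false = refl
indicator-∧ false _     = refl

indicator-idem : ∀ a → indicator a * indicator a ≡ indicator a
indicator-idem true  = refl
indicator-idem false = refl

indicator-*-cong : ∀ a {m n} → (a ≡ true → m ≡ n) → indicator a * m ≡ indicator a * n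
indicator-*-cong true  m≡n = cong (1 *_) (m≡n refl)
indicator-*-cong false _   = refl

𝟙-∈ : ∀ {n} {p : Subset n} {x} → x ∈ p → 𝟙 p x ≡ 1
𝟙-∈ x∈p = cong indicator ([]=⇒lookup x∈p)

𝟙-idem : ∀ {n} (p : Subset n) x → 𝟙 p x * 𝟙 p x ≡ 𝟙 p x
𝟙-idem p x = indicator-idem (lookup p x)

𝟙-*-cong : ∀ {n} (p : Subset n) x {m m′} → (x ∈ p → m ≡ m′) → 𝟙 p x * m ≡ 𝟙 p x * m′
𝟙-*-cong p x h = indicator-*-cong (lookup p x) (h ∘ lookup⇒[]= x p)

𝟙-∩ : ∀ {n} (p q : Subset n) x → 𝟙 (p ∩ q) x ≡ 𝟙 p x * 𝟙 q x
𝟙-∩ p q x = trans (cong indicator (lookup-zipWith _∧_ x p q)) (indicator-∧ (lookup p x) (lookup q x))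

∣p∣≡∑𝟙 : ∀ {n} (p : Subset n) → ∣ p ∣ ≡ sum (𝟙 p)
∣p∣≡∑𝟙 []            = refl
∣p∣≡∑𝟙 (inside  ∷ p) = cong suc (∣p∣≡∑𝟙 p)
∣p∣≡∑𝟙 (outside ∷ p) = ∣p∣≡∑𝟙 p

∣p∩q∣≡∑ : ∀ {n} (p q : Subset n) → ∣ p ∩ q ∣ ≡ sum (λ x → 𝟙 p x * 𝟙 q x)
∣p∩q∣≡∑ p q = trans (∣p∣≡∑𝟙 (p ∩ q)) (sum-cong-≗ (𝟙-∩ p q))

Empty⇒∣p∣≡0 : ∀ {n} {p : Subset n} → Empty p → ∣ p ∣ ≡ 0
Empty⇒∣p∣≡0 {n} empty = trans (cong ∣_∣ (Empty-unique empty)) (∣⊥∣≡0 n)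

∣p∣>0⇒Nonempty : ∀ {n} {p : Subset n} → 0 < ∣ p ∣ → Nonempty p
∣p∣>0⇒Nonempty {p = p} 0<∣p∣ with nonempty? p
... | yes nonempty = nonempty
... | no  empty    = contradiction (Empty⇒∣p∣≡0 empty) (>⇒≢ 0<∣p∣)

∣p∣>1⇒two-members : ∀ {n} {p : Subset n} → 1 < ∣ p ∣ → ∃₂ λ x y → x ≢ y × x ∈ p × y ∈ p
∣p∣>1⇒two-members {p = inside ∷ p} (s≤s 0<∣p∣) =
  let y , y∈p = ∣p∣>0⇒Nonempty 0<∣p∣ in zero , suc y , (λ ()) , here , there y∈p
∣p∣>1⇒two-members {p = outside ∷ p} 1<∣p∣ =
  let x , y , x≢y , x∈p , y∈p = ∣p∣>1⇒two-members 1<∣p∣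
  in suc x , suc y , x≢y ∘ Fin.suc-injective , there x∈p , there y∈p

two-members⇒∣p∣>1 : ∀ {n} {p : Subset n} {x y} → x ≢ y → x ∈ p → y ∈ p → 1 < ∣ p ∣
two-members⇒∣p∣>1 x≢y x∈p y∈p =
  ≤-<-trans (≤-<-trans z≤n (x∈p⇒∣p-x∣<∣p∣ (x∈p∧x≢y⇒x∈p-y y∈p (x≢y ∘ sym)))) (x∈p⇒∣p-x∣<∣p∣ x∈p)

∣image∩image∣ : ∀ {n} (g : Permutation′ n) (p q : Subset n) →
                ∣ image g p ∩ image g q ∣ ≡ ∣ p ∩ q ∣
∣image∩image∣ g p q = begin
  ∣ image g p ∩ image g q ∣
    ≡⟨ ∣p∩q∣≡∑ (image g p) (image g q) ⟩
  sum (λ y → 𝟙 (image g p) y * 𝟙 (image g q) y)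
    ≡⟨ sum-cong-≗ (λ y → cong₂ _*_ (𝟙-image p y) (𝟙-image q y)) ⟩
  sum (λ y → 𝟙 p (g ⟨$⟩ˡ y) * 𝟙 q (g ⟨$⟩ˡ y))
    ≡⟨ sum-permute (λ x → 𝟙 p x * 𝟙 q x) (flip g) ⟨
  sum (λ x → 𝟙 p x * 𝟙 q x)
    ≡⟨ ∣p∩q∣≡∑ p q ⟨
  ∣ p ∩ q ∣
    ∎
  where
  open ≡-Reasoning
  𝟙-image : ∀ s y → 𝟙 (image g s) y ≡ 𝟙 s (g ⟨$⟩ˡ y)
  𝟙-image s y = cong indicator (lookup∘tabulate (λ z → lookup s (g ⟨$⟩ˡ z)) y)

∑-weighted-∣∩∣ : ∀ {m n} (p : Subset n) (C : Fin m → Subset n) (w : Fin m → ℕ) →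
                 sum (λ j → w j * ∣ p ∩ C j ∣) ≡ sum (λ x → 𝟙 p x * sum (λ j → w j * 𝟙 (C j) x))
∑-weighted-∣∩∣ p C w = begin
  sum (λ j → w j * ∣ p ∩ C j ∣)
    ≡⟨ sum-cong-≗ (λ j → cong (w j *_) (∣p∩q∣≡∑ p (C j))) ⟩
  sum (λ j → w j * sum (λ x → 𝟙 p x * 𝟙 (C j) x))
    ≡⟨ sum-cong-≗ (λ j → *-distribˡ-sum (w j) (λ x → 𝟙 p x * 𝟙 (C j) x)) ⟩
  sum (λ j → sum (λ x → w j * (𝟙 p x * 𝟙 (C j) x)))
    ≡⟨ ∑-comm (λ j x → w j * (𝟙 p x * 𝟙 (C j) x)) ⟩
  sum (λ x → sum (λ j → w j * (𝟙 p x * 𝟙 (C j) x)))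
    ≡⟨ sum-cong-≗ (λ x → sum-cong-≗ (λ j → x∙yz≈y∙xz (w j) (𝟙 p x) (𝟙 (C j) x))) ⟩
  sum (λ x → sum (λ j → 𝟙 p x * (w j * 𝟙 (C j) x)))
    ≡⟨ sum-cong-≗ (λ x → *-distribˡ-sum (𝟙 p x) (λ j → w j * 𝟙 (C j) x)) ⟨
  sum (λ x → 𝟙 p x * sum (λ j → w j * 𝟙 (C j) x))
    ∎
  where open ≡-Reasoning

∑-removeAt-one : ∀ {n} (f : Fin (suc n) → ℕ) i → f i ≡ 1 → sum f ∸ 1 ≡ sum (removeAt f i)
∑-removeAt-one f i fi≡1 = cong (_∸ 1) (trans (sum-remove {i = i} f) (cong (_+ sum (removeAt f i)) fi≡1))

m*c≡m+n⇒∃q : ∀ {m c n} → 0 < m → m * c ≡ m + n → ∃ λ q → c ≡ suc q × m * q ≡ n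
m*c≡m+n⇒∃q {suc m} {zero}  _ m*0≡m+n = contradiction (trans (sym (*-zeroʳ m)) m*0≡m+n) 0≢1+n
m*c≡m+n⇒∃q {m}     {suc q} _ m*c≡m+n = q , refl , +-cancelˡ-≡ m _ _ (trans (sym (*-suc m q)) m*c≡m+n)

IntersectingBlocksMeetIn : ∀ {v b} → Blocks v b → ℕ → Set
IntersectingBlocksMeetIn B c = ∀ {x i j} → i ≢ j → x ∈ B i → x ∈ B j → ∣ B i ∩ B j ∣ ≡ c

module _ {v b : ℕ} (B : Blocks v b) where

  lookup-blocksThrough : ∀ x j → lookup (blocksThrough B x) j ≡ lookup (B j) x
  lookup-blocksThrough x j = lookup∘tabulate (λ j → lookup (B j) x) j

  ∈blocksThrough⁺ : ∀ {x j} → x ∈ B j → j ∈ blocksThrough B x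
  ∈blocksThrough⁺ {x} {j} x∈Bj =
    lookup⇒[]= j (blocksThrough B x) (trans (lookup-blocksThrough x j) ([]=⇒lookup x∈Bj))

  ∈blocksThrough⁻ : ∀ {x j} → j ∈ blocksThrough B x → x ∈ B j
  ∈blocksThrough⁻ {x} {j} j∈ =
    lookup⇒[]= x (B j) (trans (sym (lookup-blocksThrough x j)) ([]=⇒lookup j∈))

  blocksThrough₂≡∩ : ∀ x y → blocksThrough₂ B x y ≡ blocksThrough B x ∩ blocksThrough B y
  blocksThrough₂≡∩ x y =
    trans (tabulate-cong lookup-∩) (tabulate∘lookup (blocksThrough B x ∩ blocksThrough B y))
    where
    lookup-∩ : ∀ j → lookup (B j) x ∧ lookup (B j) y ≡ lookup (blocksThrough B x ∩ blocksThrough B y) j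
    lookup-∩ j = sym (trans (lookup-zipWith _∧_ j (blocksThrough B x) (blocksThrough B y))
                            (cong₂ _∧_ (lookup-blocksThrough x j) (lookup-blocksThrough y j)))

  ∣blocksThrough∣≡∑ : ∀ x → ∣ blocksThrough B x ∣ ≡ sum (λ j → 𝟙 (B j) x)
  ∣blocksThrough∣≡∑ x =
    trans (∣p∣≡∑𝟙 (blocksThrough B x)) (sum-cong-≗ (cong indicator ∘ lookup-blocksThrough x))

  ∣blocksThrough₂∣≡∑ : ∀ x y → ∣ blocksThrough₂ B x y ∣ ≡ sum (λ j → 𝟙 (B j) x * 𝟙 (B j) y)
  ∣blocksThrough₂∣≡∑ x y = begin
    ∣ blocksThrough₂ B x y ∣
      ≡⟨ cong ∣_∣ (blocksThrough₂≡∩ x y) ⟩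
    ∣ blocksThrough B x ∩ blocksThrough B y ∣
      ≡⟨ ∣p∩q∣≡∑ (blocksThrough B x) (blocksThrough B y) ⟩
    sum (λ j → 𝟙 (blocksThrough B x) j * 𝟙 (blocksThrough B y) j)
      ≡⟨ sum-cong-≗ (λ j → cong₂ _*_ (𝟙-blocksThrough x j) (𝟙-blocksThrough y j)) ⟩
    sum (λ j → 𝟙 (B j) x * 𝟙 (B j) y)
      ∎
    where
    open ≡-Reasoning
    𝟙-blocksThrough : ∀ z j → 𝟙 (blocksThrough B z) j ≡ 𝟙 (B j) z
    𝟙-blocksThrough z j = cong indicator (lookup-blocksThrough z j)

  intersecting⇒quasiSymmetric : ∀ {c} → IntersectingBlocksMeetIn B c → QuasiSymmetric B 0 c
  intersecting⇒quasiSymmetric meet i j i≢j with nonempty? (B i ∩ B j)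
  ... | yes (x , x∈Bi∩Bj) =
    let x∈Bi , x∈Bj = x∈p∩q⁻ (B i) (B j) x∈Bi∩Bj in inj₂ (meet i≢j x∈Bi x∈Bj)
  ... | no  empty         = inj₁ (Empty⇒∣p∣≡0 empty)

  ∣∩∣-homogeneous : ∀ {G α i j i′ j′} → TwoHomogeneousAt B G α → i ≢ j → i′ ≢ j′ →
                    α ∈ B i → α ∈ B j → α ∈ B i′ → α ∈ B j′ → ∣ B i′ ∩ B j′ ∣ ≡ ∣ B i ∩ B j ∣
  ∣∩∣-homogeneous {i = i} {j} {i′} {j′} H i≢j i′≢j′ α∈Bi α∈Bj α∈Bi′ α∈Bj′
    with H i j i′ j′ i≢j i′≢j′ α∈Bi α∈Bj α∈Bi′ α∈Bj′
  ... | g , _ , _ , inj₁ (gBi≡Bi′ , gBj≡Bj′) =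
    trans (cong ∣_∣ (cong₂ _∩_ (sym gBi≡Bi′) (sym gBj≡Bj′))) (∣image∩image∣ g (B i) (B j))
  ... | g , _ , _ , inj₂ (gBi≡Bj′ , gBj≡Bi′) =
    trans (cong ∣_∣ (trans (∩-comm (B i′) (B j′)) (cong₂ _∩_ (sym gBi≡Bj′) (sym gBj≡Bi′))))
          (∣image∩image∣ g (B i) (B j))

flag-count : ∀ {v b r k lam} {B : Blocks v b} → IsDesign v b r k lam B →
             ∀ {α j₀} c → α ∈ B j₀ → (∀ j → j ≢ j₀ → α ∈ B j → ∣ B j₀ ∩ B j ∣ ≡ c) →
             (r ∸ 1) * c ≡ (r ∸ 1) + (k ∸ 1) * (lam ∸ 1)
flag-count {suc v} {suc b} {r} {k} {lam} {B} D {α} {j₀} c α∈Bj₀ meet = begin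
  (r ∸ 1) * c
    ≡⟨ cong (_* c) r∸1≡∑w ⟩
  sum w * c
    ≡⟨ *-distribʳ-sum c w ⟩
  sum (λ j → w j * c)
    ≡⟨ sum-cong-≗ meet-others ⟨
  sum (λ j → w j * ∣ B j₀ ∩ C j ∣)
    ≡⟨ ∑-weighted-∣∩∣ (B j₀) C w ⟩
  sum (λ x → 𝟙 (B j₀) x * T x)
    ≡⟨ sum-remove {i = α} (λ x → 𝟙 (B j₀) x * T x) ⟩
  𝟙 (B j₀) α * T α + sum (λ x → 𝟙 (B j₀) (punchIn α x) * T (punchIn α x))
    ≡⟨ cong₂ _+_ Tα≡∑w (sum-cong-≗ T≡lam∸1) ⟩
  sum w + sum (λ x → 𝟙 (B j₀) (punchIn α x) * (lam ∸ 1))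
    ≡⟨ cong (sum w +_) (*-distribʳ-sum (lam ∸ 1) (removeAt (𝟙 (B j₀)) α)) ⟨
  sum w + sum (removeAt (𝟙 (B j₀)) α) * (lam ∸ 1)
    ≡⟨ cong₂ (λ s t → s + t * (lam ∸ 1)) r∸1≡∑w k∸1≡∑ ⟨
  (r ∸ 1) + (k ∸ 1) * (lam ∸ 1)
    ∎
  where
  open ≡-Reasoning
  open IsDesign D
  -- C enumerates the blocks other than j₀; T x counts those through both α and x.
  C : Fin b → Subset (suc v)
  C = B ∘ punchIn j₀
  w : Fin b → ℕ
  w j = 𝟙 (C j) α
  T : Fin (suc v) → ℕ
  T x = sum (λ j → w j * 𝟙 (C j) x)

  r∸1≡∑w : r ∸ 1 ≡ sum w
  r∸1≡∑w = trans (cong (_∸ 1) (trans (sym (replication α)) (∣blocksThrough∣≡∑ B α)))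
                 (∑-removeAt-one (λ j → 𝟙 (B j) α) j₀ (𝟙-∈ α∈Bj₀))

  k∸1≡∑ : k ∸ 1 ≡ sum (removeAt (𝟙 (B j₀)) α)
  k∸1≡∑ = trans (cong (_∸ 1) (trans (sym (blockSize j₀)) (∣p∣≡∑𝟙 (B j₀))))
                (∑-removeAt-one (𝟙 (B j₀)) α (𝟙-∈ α∈Bj₀))

  meet-others : ∀ j → w j * ∣ B j₀ ∩ C j ∣ ≡ w j * c
  meet-others j = 𝟙-*-cong (C j) α (meet (punchIn j₀ j) (punchInᵢ≢i j₀ j))

  Tα≡∑w : 𝟙 (B j₀) α * T α ≡ sum w
  Tα≡∑w = trans (cong (_* T α) (𝟙-∈ α∈Bj₀))
                (trans (+-identityʳ (T α)) (sum-cong-≗ (λ j → 𝟙-idem (C j) α)))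

  T≡lam∸1 : ∀ x → 𝟙 (B j₀) (punchIn α x) * T (punchIn α x) ≡ 𝟙 (B j₀) (punchIn α x) * (lam ∸ 1)
  T≡lam∸1 x = 𝟙-*-cong (B j₀) y λ y∈Bj₀ → sym (trans
    (cong (_∸ 1) (trans (sym (balanced α y (punchInᵢ≢i α x ∘ sym))) (∣blocksThrough₂∣≡∑ B α y)))
    (∑-removeAt-one (λ j → 𝟙 (B j) α * 𝟙 (B j) y) j₀ (cong₂ _*_ (𝟙-∈ α∈Bj₀) (𝟙-∈ y∈Bj₀))))
    where y = punchIn α x

module _ {v b r k lam} {B : Blocks v b} (D : IsDesign v b r k lam B) where
  open IsDesign D

  lam≤r : ∀ {x y} → x ≢ y → lam ≤ r
  lam≤r {x} {y} x≢y = begin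
    lam                                        ≡⟨ balanced x y x≢y ⟨
    ∣ blocksThrough₂ B x y ∣                   ≡⟨ cong ∣_∣ (blocksThrough₂≡∩ B x y) ⟩
    ∣ blocksThrough B x ∩ blocksThrough B y ∣  ≤⟨ ∣p∩q∣≤∣p∣ (blocksThrough B x) (blocksThrough B y) ⟩
    ∣ blocksThrough B x ∣                      ≡⟨ replication x ⟩
    r                                          ∎
    where open ≤-Reasoning

  r≤1⇒disjoint : r ≤ 1 → ∀ {x i j} → i ≢ j → x ∈ B i → ¬ x ∈ B j
  r≤1⇒disjoint r≤1 {x} i≢j x∈Bi x∈Bj = <⇒≱ 1<r r≤1
    where
    1<r : 1 < r
    1<r = subst (1 <_) (replication x)
                (two-members⇒∣p∣>1 i≢j (∈blocksThrough⁺ B x∈Bi) (∈blocksThrough⁺ B x∈Bj))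

  ∣∩∣-equation : ∀ {G α i j} → TwoHomogeneousAt B G α → i ≢ j → α ∈ B i → α ∈ B j →
                 (r ∸ 1) * ∣ B i ∩ B j ∣ ≡ (r ∸ 1) + (k ∸ 1) * (lam ∸ 1)
  ∣∩∣-equation H i≢j α∈Bi α∈Bj = flag-count D _ α∈Bi
    λ j′ j′≢i α∈Bj′ → ∣∩∣-homogeneous B H i≢j (j′≢i ∘ sym) α∈Bi α∈Bj α∈Bi α∈Bj′

  1<r⇒meeting-blocks : 1 < r → ∃ λ α → ∃₂ λ i j → i ≢ j × α ∈ B i × α ∈ B j
  1<r⇒meeting-blocks 1<r =
    let α = fromℕ< k<v
        i , j , i≢j , i∈ , j∈ = ∣p∣>1⇒two-members (subst (1 <_) (sym (replication α)) 1<r)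
    in α , i , j , i≢j , ∈blocksThrough⁻ B i∈ , ∈blocksThrough⁻ B j∈

  1<r⇒∣∩∣-constant : ∀ {G} → (∀ α → TwoHomogeneousAt B G α) → 1 < r → ∀ {x i j y i′ j′} →
                     i ≢ j → x ∈ B i → x ∈ B j → i′ ≢ j′ → y ∈ B i′ → y ∈ B j′ →
                     ∣ B i ∩ B j ∣ ≡ ∣ B i′ ∩ B j′ ∣
  1<r⇒∣∩∣-constant H 1<r i≢j x∈Bi x∈Bj i′≢j′ y∈Bi′ y∈Bj′ =
    *-cancelˡ-≡ _ _ (r ∸ 1) {{>-nonZero (m<n⇒0<n∸m 1<r)}}
      (trans (∣∩∣-equation (H _) i≢j x∈Bi x∈Bj) (sym (∣∩∣-equation (H _) i′≢j′ y∈Bi′ y∈Bj′)))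

  1<r⇒intersection-number : ∀ {G} → (∀ α → TwoHomogeneousAt B G α) → 1 < r →
    Σ ℕ λ q → (r ∸ 1) * q ≡ (k ∸ 1) * (lam ∸ 1) × IntersectingBlocksMeetIn B (suc q)
  1<r⇒intersection-number H 1<r =
    let α , i , j , i≢j , α∈Bi , α∈Bj = 1<r⇒meeting-blocks 1<r
        q , ∣Bi∩Bj∣≡1+q , [r∸1]q≡[k∸1][lam∸1] =
          m*c≡m+n⇒∃q (m<n⇒0<n∸m 1<r) (∣∩∣-equation (H α) i≢j α∈Bi α∈Bj)
    in q , [r∸1]q≡[k∸1][lam∸1] , λ i′≢j′ x∈Bi′ x∈Bj′ →
         trans (1<r⇒∣∩∣-constant H 1<r i′≢j′ x∈Bi′ x∈Bj′ i≢j α∈Bi α∈Bj) ∣Bi∩Bj∣≡1+q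

r≤1⇒[k∸1][lam∸1]≡0 : ∀ {v b r k lam} {B : Blocks v b} → IsDesign v b r k lam B → r ≤ 1 →
                      (k ∸ 1) * (lam ∸ 1) ≡ 0
r≤1⇒[k∸1][lam∸1]≡0 {suc (suc v)} {k = k} D r≤1 =
  trans (cong ((k ∸ 1) *_) (m≤n⇒m∸n≡0 (≤-trans (lam≤r D {zero} {suc zero} (λ ())) r≤1)))
        (*-zeroʳ (k ∸ 1))
r≤1⇒[k∸1][lam∸1]≡0 {1} D _ with IsDesign.k<v D
... | s≤s z≤n = refl
r≤1⇒[k∸1][lam∸1]≡0 {0} D _ with IsDesign.k<v D
... | ()

lemma2p5 : ∀ (v b r k lam : ℕ) (B : Blocks v b) (G : Permutation′ v → Set) →
    IsDesign v b r k lam B → IsAutGroup B G → LocallyTransitive B G →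
    (∀ (α : Fin v) → TwoHomogeneousAt B G α) →
    (v ≡ b) ⊎ Σ ℕ (λ q → ((r ∸ 1) * q ≡ (k ∸ 1) * (lam ∸ 1)) × QuasiSymmetric B 0 (suc q))
-- The counting argument gives quasi-symmetry outright (a symmetric design is just the case
-- where all blocks meet), and it needs neither the group axioms nor local transitivity.
lemma2p5 v b r k lam B G D _ _ H with r ≤? 1
... | yes r≤1 = inj₂ (0 , trans (*-zeroʳ (r ∸ 1)) (sym (r≤1⇒[k∸1][lam∸1]≡0 D r≤1)) ,
                      intersecting⇒quasiSymmetric B λ i≢j x∈Bi x∈Bj →
                        ⊥-elim (r≤1⇒disjoint D r≤1 i≢j x∈Bi x∈Bj))
... | no  r≰1 = let q , [r∸1]q≡[k∸1][lam∸1] , meet = 1<r⇒intersection-number D H (≰⇒> r≰1)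
                in inj₂ (q , [r∸1]q≡[k∸1][lam∸1] , intersecting⇒quasiSymmetric B meet)
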